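{- If $n\in\mathbb{N}$, then $\mathcal{Q}(n)$ is a $2$-chain.
   Context: All posets are finite; partial orders are written $\preceq$, with $p\prec q$ meaning $p\preceq q$, $p\ne q$. A poset $(P,\preceq)$ is a $2$-chain if (1) there is a unique way to write $P$ as the union of two chains, and (2) $\preceq$ is maximal subject to (1), i.e. for every proper refinement $\preceq^+$ of $\preceq$ there is more than one way to write $P$ as the union of two $\preceq^+$-chains. $\mathcal{Q}(n)=\{1,\dots,n\}$ with $i\prec j$ if and only if $i\leq j-2$ in the usual order. -}

module Defs where

open import Data.Nat using (ℕ; _+_; _≤ᵇ_)
open import Data.Fin using (Fin; toℕ; _≟_)
open import Data.Bool using (Bool; true; false; not; _∨_)
open import Data.Product using (Σ; _×_; ∃; ∃-syntax)
open import Data.Sum using (_⊎_)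
open import Relation.Nullary using (¬_)
open import Relation.Nullary.Decidable using (⌊_⌋)
open import Relation.Binary.PropositionalEquality using (_≡_)

BRel : ℕ → Set
BRel n = Fin n → Fin n → Bool

record IsPO {n : ℕ} (R : BRel n) : Set where
  field
    refl′  : ∀ x → R x x ≡ true
    antisym : ∀ x y → R x y ≡ true → R y x ≡ true → x ≡ y
    trans′ : ∀ x y z → R x y ≡ true → R y z ≡ true → R x z ≡ true

-- A way of writing the ground set as the union of two (disjoint) chains,
-- encoded as a colouring c : Fin n → Bool whose two colour classes
-- {x | c x ≡ true} and {x | c x ≡ false} are chains (either may be empty).
IsTwoChainCover : {n : ℕ} → BRel n → (Fin n → Bool) → Set
IsTwoChainCover {n} R c =
  ∀ (x y : Fin n) → c x ≡ c y → (R x y ≡ true) ⊎ (R y x ≡ true)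

-- Two colourings describe the same (unordered) pair of chains.
SameCover : {n : ℕ} → (Fin n → Bool) → (Fin n → Bool) → Set
SameCover {n} c d = (∀ (x : Fin n) → c x ≡ d x) ⊎ (∀ (x : Fin n) → c x ≡ not (d x))

UniqueTwoChainCover : {n : ℕ} → BRel n → Set
UniqueTwoChainCover {n} R =
  Σ (Fin n → Bool) λ c → IsTwoChainCover R c ×
    (∀ (d : Fin n → Bool) → IsTwoChainCover R d → SameCover d c)

SeveralTwoChainCovers : {n : ℕ} → BRel n → Set
SeveralTwoChainCovers {n} R =
  Σ (Fin n → Bool) λ c → Σ (Fin n → Bool) λ d →
    IsTwoChainCover R c × IsTwoChainCover R d × ¬ SameCover c d

ProperRefinement : {n : ℕ} → BRel n → BRel n → Set
ProperRefinement {n} R S =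
  (∀ (x y : Fin n) → R x y ≡ true → S x y ≡ true) ×
  (∃[ x ] ∃[ y ] (S x y ≡ true × R x y ≡ false))

record Is2Chain {n : ℕ} (R : BRel n) : Set where
  field
    isPO    : IsPO R
    unique  : UniqueTwoChainCover R
    maximal : ∀ (S : BRel n) → IsPO S → ProperRefinement R S →
              SeveralTwoChainCovers S

-- 𝒬(n): ground set {1,…,n} (here encoded as Fin n = {0,…,n-1}, a shift by 1),
-- with i ⪯ j iff i = j or i ≤ j - 2, i.e. i + 2 ≤ j.
Q : (n : ℕ) → BRel n
Q n i j = ⌊ i ≟ j ⌋ ∨ (toℕ i + 2 ≤ᵇ toℕ j)

-- Two elements of 𝒬(n) are comparable unless they are consecutive, so a
-- colouring by two chains is exactly a colouring in which consecutive elements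
-- get different colours, and the parity colouring is the only one.  A partial
-- order properly refining 𝒬(n) cannot relate two elements at distance at
-- least 2 in a new way (they are already comparable, and antisymmetry forbids
-- the reverse relation), so it makes some consecutive pair a, a+1 comparable;
-- then the colouring that alternates everywhere except between a and a+1 is a
-- second cover.
module Submission where

open import Data.Nat using (ℕ; zero; suc; _+_; _≤_; _≰_; s≤s; z≤n)
open import Data.Nat.Properties using (≤ᵇ⇒≤; ≤⇒≤ᵇ; ≤-trans; m≤m+n; n≤1+n; m+1+n≰m; 1+n≢n; +-suc)
  renaming (_≟_ to _≟ℕ_)
open import Data.Fin using (Fin; toℕ; _≟_; inject₁) renaming (zero to fzero; suc to fsuc)
open import Data.Fin.Properties using (toℕ-injective; toℕ-inject₁)
open import Data.Fin.Induction using (<-weakInduction)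
open import Data.Bool using (Bool; true; false; not; if_then_else_)
  renaming (_≟_ to _≟ᴮ_)
open import Data.Bool.Properties using (not-¬; ¬-not; T-≡)
open import Data.Empty using (⊥-elim)
open import Data.Product using (_,_)
open import Data.Sum using (_⊎_; inj₁; inj₂; swap)
open import Function using (_∘_; Equivalence)
open import Relation.Nullary using (¬_; yes; no; does)
open import Relation.Nullary.Decidable using (dec-true; dec-false)
open import Relation.Binary.PropositionalEquality
open import Defs

data Distance (u v : ℕ) : Set where
  equal     : u ≡ v → Distance u v
  farBelow  : u + 2 ≤ v → Distance u v
  farAbove  : v + 2 ≤ u → Distance u v
  justBelow : v ≡ suc u → Distance u v
  justAbove : u ≡ suc v → Distance u v

distance : ∀ u v → Distance u v
distance zero          zero          = equal refl
distance zero          (suc zero)    = justBelow refl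
distance zero          (suc (suc v)) = farBelow (s≤s (s≤s z≤n))
distance (suc zero)    zero          = justAbove refl
distance (suc (suc u)) zero          = farAbove (s≤s (s≤s z≤n))
distance (suc u)       (suc v) with distance u v
... | equal u≡v     = equal (cong suc u≡v)
... | farBelow u≪v  = farBelow (s≤s u≪v)
... | farAbove v≪u  = farAbove (s≤s v≪u)
... | justBelow v≡u = justBelow (cong suc v≡u)
... | justAbove u≡v = justAbove (cong suc u≡v)

far-trans : ∀ {u v w} → u + 2 ≤ v → v + 2 ≤ w → u + 2 ≤ w
far-trans {v = v} u≪v v≪w = ≤-trans u≪v (≤-trans (m≤m+n v 2) v≪w)

far-asym : ∀ {u v} → u + 2 ≤ v → ¬ (v + 2 ≤ u)
far-asym {u} u≪v v≪u = m+1+n≰m u (far-trans u≪v v≪u)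

far⇒¬next : ∀ u → u + 2 ≰ suc u
far⇒¬next u u≪1+u = m+1+n≰m (suc u) (subst (_≤ suc u) (+-suc u 1) u≪1+u)

far⇒¬prev : ∀ u → suc u + 2 ≰ u
far⇒¬prev u 1+u≪u = m+1+n≰m u (≤-trans (n≤1+n _) 1+u≪u)

switching : (ℕ → Bool) → ℕ → Bool
switching flips zero    = true
switching flips (suc k) = if flips k then not (switching flips k) else switching flips k

switching-flip : ∀ flips {k} → flips k ≡ true → switching flips (suc k) ≡ not (switching flips k)
switching-flip flips {k} flipped rewrite flipped = refl

switching-hold : ∀ flips {k} → flips k ≡ false → switching flips (suc k) ≡ switching flips k
switching-hold flips {k} held rewrite held = refl

alternating : ℕ → Bool
alternating = switching (λ _ → true)

Comparable : ∀ {n} → BRel n → Fin n → Fin n → Set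
Comparable R x y = R x y ≡ true ⊎ R y x ≡ true

Adjacent : ∀ {n} → Fin n → Fin n → Set
Adjacent a b = toℕ b ≡ suc (toℕ a)

_⊆ᴮ_ : ∀ {n} → BRel n → BRel n → Set
R ⊆ᴮ S = ∀ x y → R x y ≡ true → S x y ≡ true

Alternating : ∀ {n} → (Fin n → Bool) → Set
Alternating d = ∀ {a b} → Adjacent a b → d b ≡ not (d a)

inject₁-adjacent : ∀ {n} (i : Fin n) → Adjacent (inject₁ i) (fsuc i)
inject₁-adjacent i = cong suc (sym (toℕ-inject₁ i))

alternating-sameCover : ∀ {n} {c d : Fin n → Bool} → Alternating c → Alternating d → SameCover c d
alternating-sameCover {zero}            _     _     = inj₁ (λ ())
alternating-sameCover {suc n} {c} {d} c-alt d-alt with c fzero ≟ᴮ d fzero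
... | yes c₀≡d₀ = inj₁ (<-weakInduction (λ i → c i ≡ d i) c₀≡d₀ step)
  where
  step : ∀ i → c (inject₁ i) ≡ d (inject₁ i) → c (fsuc i) ≡ d (fsuc i)
  step i c≡d = trans (c-alt (inject₁-adjacent i))
                     (trans (cong not c≡d) (sym (d-alt (inject₁-adjacent i))))
... | no c₀≢d₀ = inj₂ (<-weakInduction (λ i → c i ≡ not (d i)) (¬-not c₀≢d₀) step)
  where
  step : ∀ i → c (inject₁ i) ≡ not (d (inject₁ i)) → c (fsuc i) ≡ not (d (fsuc i))
  step i c≡¬d = trans (c-alt (inject₁-adjacent i))
                      (cong not (trans c≡¬d (sym (d-alt (inject₁-adjacent i)))))

sameCover-respects-≡ : ∀ {n} {c d : Fin n → Bool} → SameCover c d →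
                       ∀ {a b} → d a ≡ d b → c a ≡ c b
sameCover-respects-≡ (inj₁ c≡d)  {a} {b} da≡db = trans (c≡d a) (trans da≡db (sym (c≡d b)))
sameCover-respects-≡ (inj₂ c≡¬d) {a} {b} da≡db =
  trans (c≡¬d a) (trans (cong not da≡db) (sym (c≡¬d b)))

module _ {n : ℕ} where

  Q-sound : ∀ {i j : Fin n} → Q n i j ≡ true → i ≡ j ⊎ toℕ i + 2 ≤ toℕ j
  Q-sound {i} {j} Qij with i ≟ j
  ... | yes i≡j = inj₁ i≡j
  ... | no _    = inj₂ (≤ᵇ⇒≤ (toℕ i + 2) (toℕ j) (Equivalence.from T-≡ Qij))

  Q-reflexive : ∀ {i j : Fin n} → i ≡ j → Q n i j ≡ true
  Q-reflexive {i} {j} i≡j with i ≟ j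
  ... | yes _   = refl
  ... | no i≢j  = ⊥-elim (i≢j i≡j)

  Q-far : ∀ {i j : Fin n} → toℕ i + 2 ≤ toℕ j → Q n i j ≡ true
  Q-far {i} {j} i≪j with i ≟ j
  ... | yes _ = refl
  ... | no _  = Equivalence.to T-≡ (≤⇒≤ᵇ i≪j)

  Q-isPO : IsPO (Q n)
  Q-isPO = record { refl′ = λ x → Q-reflexive {x} refl ; antisym = antisym ; trans′ = trans′ }
    where
    antisym : ∀ x y → Q n x y ≡ true → Q n y x ≡ true → x ≡ y
    antisym x y Qxy Qyx with Q-sound {x} {y} Qxy | Q-sound {y} {x} Qyx
    ... | inj₁ x≡y | _        = x≡y
    ... | inj₂ _   | inj₁ y≡x = sym y≡x
    ... | inj₂ x≪y | inj₂ y≪x = ⊥-elim (far-asym x≪y y≪x)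

    trans′ : ∀ x y z → Q n x y ≡ true → Q n y z ≡ true → Q n x z ≡ true
    trans′ x y z Qxy Qyz with Q-sound {x} {y} Qxy | Q-sound {y} {z} Qyz
    ... | inj₁ refl | _         = Qyz
    ... | inj₂ _    | inj₁ refl = Qxy
    ... | inj₂ x≪y  | inj₂ y≪z  = Q-far (far-trans x≪y y≪z)

  adjacent⇒incomparable : ∀ {a b : Fin n} → Adjacent a b → ¬ Comparable (Q n) a b
  adjacent⇒incomparable {a} {b} a~b (inj₁ Qab) with Q-sound {a} {b} Qab
  ... | inj₁ refl = 1+n≢n (sym a~b)
  ... | inj₂ a≪b  = far⇒¬next (toℕ a) (subst (toℕ a + 2 ≤_) a~b a≪b)
  adjacent⇒incomparable {a} {b} a~b (inj₂ Qba) with Q-sound {b} {a} Qba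
  ... | inj₁ refl = 1+n≢n (sym a~b)
  ... | inj₂ b≪a  = far⇒¬prev (toℕ a) (subst (λ m → m + 2 ≤ toℕ a) a~b b≪a)

  cover-from-adjacent : ∀ {S : BRel n} → Q n ⊆ᴮ S → (d : Fin n → Bool) →
                        (∀ {a b} → Adjacent a b → d a ≡ d b → Comparable S a b) →
                        IsTwoChainCover S d
  cover-from-adjacent Q⊆S d adjacent-ok x y dx≡dy with distance (toℕ x) (toℕ y)
  ... | equal x≡y     = inj₁ (Q⊆S x y (Q-reflexive (toℕ-injective {i = x} x≡y)))
  ... | farBelow x≪y  = inj₁ (Q⊆S x y (Q-far x≪y))
  ... | farAbove y≪x  = inj₂ (Q⊆S y x (Q-far y≪x))
  ... | justBelow x~y = adjacent-ok x~y dx≡dy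
  ... | justAbove y~x = swap (adjacent-ok y~x (sym dx≡dy))

  switching-cover : ∀ {S : BRel n} → Q n ⊆ᴮ S → ∀ flips →
                    (∀ {a b} → Adjacent a b → flips (toℕ a) ≡ false → Comparable S a b) →
                    IsTwoChainCover S (switching flips ∘ toℕ)
  switching-cover {S} Q⊆S flips held-ok = cover-from-adjacent Q⊆S _ same-colour-ok
    where
    same-colour-ok : ∀ {a b} → Adjacent a b →
                     switching flips (toℕ a) ≡ switching flips (toℕ b) → Comparable S a b
    same-colour-ok {a} a~b same with flips (toℕ a) in flipped
    ... | false = held-ok a~b flipped
    ... | true  = ⊥-elim (not-¬ refl (trans same (trans (cong (switching flips) a~b)
                                                          (switching-flip flips flipped))))

  cover-alternates : ∀ {d : Fin n → Bool} → IsTwoChainCover (Q n) d → Alternating d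
  cover-alternates cover a~b =
    ¬-not (λ db≡da → adjacent⇒incomparable a~b (cover _ _ (sym db≡da)))

  parity : Fin n → Bool
  parity = alternating ∘ toℕ

  parity-cover : IsTwoChainCover (Q n) parity
  parity-cover = switching-cover (λ _ _ Qxy → Qxy) (λ _ → true) (λ _ ())

  Q-unique : UniqueTwoChainCover (Q n)
  Q-unique = parity , parity-cover , λ d d-cover →
    alternating-sameCover (cover-alternates d-cover) (cover-alternates parity-cover)

  refinement-adds-adjacent : ∀ {S : BRel n} → IsPO S → Q n ⊆ᴮ S →
                             ∀ {x y} → S x y ≡ true → Q n x y ≡ false →
                             Adjacent x y ⊎ Adjacent y x
  refinement-adds-adjacent {S} S-po Q⊆S {x} {y} Sxy ¬Qxy with distance (toℕ x) (toℕ y)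
  ... | equal x≡y     = ⊥-elim (not-¬ (Q-reflexive (toℕ-injective {i = x} x≡y)) ¬Qxy)
  ... | farBelow x≪y  = ⊥-elim (not-¬ (Q-far x≪y) ¬Qxy)
  ... | farAbove y≪x  =
    ⊥-elim (not-¬ (Q-reflexive (IsPO.antisym S-po x y Sxy (Q⊆S y x (Q-far y≪x)))) ¬Qxy)
  ... | justBelow x~y = inj₁ x~y
  ... | justAbove y~x = inj₂ y~x

  two-covers : ∀ {S : BRel n} → Q n ⊆ᴮ S → ∀ {a₀ b₀} → Adjacent a₀ b₀ →
               Comparable S a₀ b₀ → SeveralTwoChainCovers S
  two-covers {S} Q⊆S {a₀} {b₀} a₀~b₀ a₀b₀-comparable =
    parity , broken , switching-cover Q⊆S (λ _ → true) (λ _ ()) ,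
    switching-cover Q⊆S flips only-new-pair-held , different
    where
    t : ℕ
    t = toℕ a₀

    flips : ℕ → Bool
    flips k = not (does (k ≟ℕ t))

    broken : Fin n → Bool
    broken = switching flips ∘ toℕ

    only-new-pair-held : ∀ {a b} → Adjacent a b → flips (toℕ a) ≡ false → Comparable S a b
    only-new-pair-held {a} {b} a~b held with toℕ a ≟ℕ t
    ... | yes a≡a₀ = subst₂ (Comparable S) (toℕ-injective {i = a₀} (sym a≡a₀))
                            (toℕ-injective {i = b₀} (trans a₀~b₀ (sym (trans a~b (cong suc a≡a₀)))))
                            a₀b₀-comparable
    ... | no a≢a₀  = ⊥-elim (not-¬ (cong not (dec-false (toℕ a ≟ℕ t) a≢a₀)) held)

    different : ¬ SameCover parity broken
    different same = not-¬ refl (trans (sym (sameCover-respects-≡ same {b₀} {a₀} broken-holds))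
                                       (cover-alternates parity-cover a₀~b₀))
      where
      broken-holds : broken b₀ ≡ broken a₀
      broken-holds = trans (cong (switching flips) a₀~b₀)
                           (switching-hold flips {t} (cong not (dec-true (t ≟ℕ t) refl)))

  Q-maximal : ∀ (S : BRel n) → IsPO S → ProperRefinement (Q n) S → SeveralTwoChainCovers S
  Q-maximal S S-po (Q⊆S , x , y , Sxy , ¬Qxy) with refinement-adds-adjacent S-po Q⊆S Sxy ¬Qxy
  ... | inj₁ x~y = two-covers Q⊆S x~y (inj₁ Sxy)
  ... | inj₂ y~x = two-covers Q⊆S y~x (inj₂ Sxy)

proposition2p1 : (n : ℕ) → Is2Chain (Q n)
proposition2p1 n = record { isPO = Q-isPO ; unique = Q-unique ; maximal = Q-maximal }
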